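{- Let $d$ be a positive integer, let $H=(V,E)$ be a reduced $d$-flat hypergraph, and let $n=|V|$. Then $\|H\|=O(n^d)$.
   Context: A hypergraph is a pair $H=(V,E)$ with $V$ finite and $E\subseteq 2^V$; its size is $\|H\|=\sum_{e\in E}|e|$. For $d\ge1$, a $d$-semi-ladder in $H$ is a pair $(W,F)$ with $W=\{w_0,\ldots,w_d\}\subseteq V$, $F=\{f_0,\ldots,f_d\}\subseteq E$, $w_i\notin f_i$ for each $i$, and $w_i\in f_j$ whenever $i<j$. $H$ is $d$-flat if it has no $(d+1)$-semi-ladder. $H$ is reduced if $\bigcap_{e\in E}e=\emptyset$. -}

module Defs where

open import Data.Nat using (ℕ; suc)
open import Data.Fin using (Fin) renaming (_<_ to _<ᶠ_)
open import Data.Fin.Subset using (Subset; _∈_; _∉_; ∣_∣)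
open import Data.List using (List; map)
open import Data.Nat.ListAction using (sum)
open import Data.List.Membership.Propositional using () renaming (_∈_ to _∈ₗ_)
open import Data.Product using (Σ; ∃; _×_)
open import Relation.Nullary using (¬_)

-- A hypergraph on vertex set V = Fin n is given by its edge set E,
-- represented as a duplicate-free list of subsets of Fin n
-- (duplicate-freeness is imposed in the theorem via Unique).

size : {n : ℕ} → List (Subset n) → ℕ
size E = sum (map ∣_∣ E)

-- reduced: ⋂_{e∈E} e = ∅, i.e. every vertex misses some edge
-- (for E = ∅ the empty intersection is V, so reduced iff V = ∅; this agrees)
Reduced : {n : ℕ} → List (Subset n) → Set
Reduced {n} E = (v : Fin n) → ∃ λ e → e ∈ₗ E × v ∉ e

-- a d-semi-ladder: vertices w_0..w_d, edges f_0..f_d of E with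
-- w_i ∉ f_i and w_i ∈ f_j for i < j.  (Distinctness of the w_i and of
-- the f_i follows automatically from these conditions.)
SemiLadder : {n : ℕ} → List (Subset n) → ℕ → Set
SemiLadder {n} E d =
  Σ (Fin (suc d) → Fin n) λ w →
  Σ (Fin (suc d) → Subset n) λ f →
    ((i : Fin (suc d)) → f i ∈ₗ E) ×
    ((i : Fin (suc d)) → w i ∉ f i) ×
    ((i j : Fin (suc d)) → i <ᶠ j → w i ∈ f j)

Flat : {n : ℕ} → List (Subset n) → ℕ → Set
Flat E d = ¬ SemiLadder E (suc d)

-- Double counting gives ‖H‖ = Σ_v deg v, so it suffices to bound every degree by O(n^(d-1)).
-- Since H is reduced, some edge f₀ misses v, and (v, f₀) can be put in front of any semi-ladder
-- of the edges through v; so these edges admit no semi-ladder with d + 1 rungs.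
-- A duplicate-free family of edges that agree outside a vertex set U and admits no semi-ladder
-- with j + 2 rungs has at most 2 (|U| + 1)^j members, by induction on j and U: pick v ∈ U.
-- If every edge contains v, the edges already agree outside U - v.  Otherwise an edge missing v
-- is a rung in front of the edges through v, so these admit only j + 1 rungs, while the edges
-- missing v agree outside U - v.  For j = 0 both parts have at most one member, since two
-- distinct members of either part would yield a semi-ladder with two rungs.
module Submission where

open import Defs
open import Data.Nat using (ℕ; zero; suc; _+_; _*_; _^_; _≤_; z≤n; s≤s)
open import Data.Nat.Properties
open import Data.Fin using (Fin; zero; suc) renaming (_<_ to _<ᶠ_)
import Data.Fin as Fin
open import Data.Fin.Subset using (Subset; inside; outside; _∈_; _∉_; _⊆_; ∣_∣)
open import Data.Fin.Subset.Properties using (_∈?_; ⊆-antisym)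
open import Data.List using (List; []; _∷_; length; filter; allFin)
open import Data.List.Properties using (length-tabulate)
open import Data.List.Relation.Unary.All as All using (All; all?; _∷_)
open import Data.List.Relation.Unary.All.Properties using (¬All⇒Any¬)
open import Data.List.Relation.Unary.AllPairs using (_∷_)
open import Data.List.Relation.Unary.Any using (here; there)
open import Data.List.Relation.Unary.Unique.Propositional using (Unique)
open import Data.List.Relation.Unary.Unique.Propositional.Properties as Unique using ()
open import Data.List.Membership.Propositional using (find) renaming (_∈_ to _∈ₗ_; _∉_ to _∉ₗ_)
open import Data.List.Membership.Propositional.Properties using (∈-filter⁺; ∈-filter⁻; ∈-allFin)
open import Data.List.Relation.Binary.Subset.Propositional using () renaming (_⊆_ to _⊆ₗ_)
open import Data.List.Relation.Binary.Subset.Propositional.Properties using (filter-⊆; filter⁺′)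
open import Data.Product using (Σ; ∃; _×_; _,_; proj₁; proj₂)
open import Data.Empty using (⊥)
open import Data.Vec using ([]; _∷_)
open import Data.Vec.Functional using () renaming (_∷_ to _∷ᵛ_)
open import Function using (_∘_; id)
open import Relation.Nullary using (¬_; yes; no; contradiction)
open import Relation.Nullary.Decidable using (decidable-stable)
open import Relation.Unary using (Decidable)
open import Relation.Unary.Properties using (∁?)
open import Relation.Binary.PropositionalEquality
open import Algebra.Properties.CommutativeMonoid.Sum +-0-commutativeMonoid
  using (sum-syntax; sum-cong-≗; sum-replicate-zero; ∑-distrib-+)
open import Data.Nat.Tactic.RingSolver using (solve-∀)

length-filter+length-filter-∁ : ∀ {a p} {A : Set a} {P : A → Set p} (P? : Decidable P) xs →
  length (filter P? xs) + length (filter (∁? P?) xs) ≡ length xs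
length-filter+length-filter-∁ P? [] = refl
length-filter+length-filter-∁ P? (x ∷ xs) with P? x
... | yes _ = cong suc (length-filter+length-filter-∁ P? xs)
... | no  _ = trans (+-suc _ _) (cong suc (length-filter+length-filter-∁ P? xs))

[1+m]^j+m^[1+j]≤[1+m]^[1+j] : ∀ m j → suc m ^ j + m ^ suc j ≤ suc m ^ suc j
[1+m]^j+m^[1+j]≤[1+m]^[1+j] m j = +-monoʳ-≤ (suc m ^ j) (*-monoʳ-≤ m (^-monoˡ-≤ j (n≤1+n m)))

module _ {n : ℕ} where

  containing avoiding : Fin n → List (Subset n) → List (Subset n)
  containing v = filter (v ∈?_)
  avoiding   v = filter (∁? (v ∈?_))

  ∈-containing⁻ : ∀ {v f} L → f ∈ₗ containing v L → f ∈ₗ L × v ∈ f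
  ∈-containing⁻ L = ∈-filter⁻ _ {xs = L}

  ∈-avoiding⁻ : ∀ {v f} L → f ∈ₗ avoiding v L → f ∈ₗ L × v ∉ f
  ∈-avoiding⁻ L = ∈-filter⁻ _ {xs = L}

  -- The rungs after the first rung (w, f) form a semi-ladder of the edges containing w.
  data Ladder : List (Subset n) → ℕ → Set where
    []   : ∀ {L} → Ladder L 0
    rung : ∀ {L k w f} → f ∈ₗ L → w ∉ f → Ladder (containing w L) k → Ladder L (suc k)

  Ladder-mono : ∀ {L M k} → L ⊆ₗ M → Ladder L k → Ladder M k
  Ladder-mono L⊆M []                 = []
  Ladder-mono L⊆M (rung f∈L w∉f lad) = rung (L⊆M f∈L) w∉f (Ladder-mono (filter⁺′ _ _ id L⊆M) lad)

  AgreeOutside : List (Fin n) → List (Subset n) → Set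
  AgreeOutside U L = ∀ {f g x} → f ∈ₗ L → g ∈ₗ L → x ∉ₗ U → x ∈ f → x ∈ g

  AgreeOutside-⊆ : ∀ {U L M} → M ⊆ₗ L → AgreeOutside U L → AgreeOutside U M
  AgreeOutside-⊆ M⊆L agree f∈M g∈M = agree (M⊆L f∈M) (M⊆L g∈M)

  AgreeOutside-∷ : ∀ {v U L} → AgreeOutside (v ∷ U) L →
    (∀ {f g} → f ∈ₗ L → g ∈ₗ L → v ∈ f → v ∈ g) → AgreeOutside U L
  AgreeOutside-∷ {v} agree agreeᵥ {x = x} f∈L g∈L x∉U x∈f with x Fin.≟ v
  ... | yes refl = agreeᵥ f∈L g∈L x∈f
  ... | no  x≢v  = agree f∈L g∈L (λ { (here x≡v) → x≢v x≡v ; (there x∈U) → x∉U x∈U }) x∈f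

  pairwise-⊆⇒length≤1 : ∀ {L : List (Subset n)} → Unique L →
    (∀ {f g} → f ∈ₗ L → g ∈ₗ L → f ⊆ g) → length L ≤ 1
  pairwise-⊆⇒length≤1 {[]}         _                 _ = z≤n
  pairwise-⊆⇒length≤1 {_ ∷ []}     _                 _ = s≤s z≤n
  pairwise-⊆⇒length≤1 {_ ∷ _ ∷ _} ((f≢g ∷ _) ∷ _) ⊆ =
    contradiction (⊆-antisym (⊆ (here refl) (there (here refl))) (⊆ (there (here refl)) (here refl)))
      f≢g

  unseparated⇒⊆ : ∀ {f g : Subset n} → (∀ {x} → x ∉ g → x ∈ f → ⊥) → f ⊆ g
  unseparated⇒⊆ {g = g} unseparated {x} x∈f =
    decidable-stable (x ∈? g) (λ x∉g → unseparated x∉g x∈f)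

  ¬Ladder₁⇒length≤1 : ∀ {L} → Unique L → ¬ Ladder L 1 → length L ≤ 1
  ¬Ladder₁⇒length≤1 u ¬lad =
    pairwise-⊆⇒length≤1 u (λ _ g∈L → unseparated⇒⊆ (λ x∉g _ → ¬lad (rung g∈L x∉g [])))

  AgreeOutside[]⇒length≤1 : ∀ {L} → Unique L → AgreeOutside [] L → length L ≤ 1
  AgreeOutside[]⇒length≤1 u agree = pairwise-⊆⇒length≤1 u (λ f∈L g∈L → agree f∈L g∈L (λ ()))

  AgreeOutside-all∋ : ∀ {v U L} → AgreeOutside (v ∷ U) L → All (v ∈_) L → AgreeOutside U L
  AgreeOutside-all∋ agree all∋v = AgreeOutside-∷ agree (λ _ g∈L _ → All.lookup all∋v g∈L)

  AgreeOutside-avoiding : ∀ {v U L} → AgreeOutside (v ∷ U) L → AgreeOutside U (avoiding v L)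
  AgreeOutside-avoiding {v} {L = L} agree =
    AgreeOutside-∷ (AgreeOutside-⊆ (filter-⊆ (∁? (v ∈?_)) L) agree)
      (λ f∈ _ v∈f → contradiction v∈f (proj₂ (∈-avoiding⁻ L f∈)))

  length-containing+avoiding : ∀ v L → length (containing v L) + length (avoiding v L) ≡ length L
  length-containing+avoiding v = length-filter+length-filter-∁ (v ∈?_)

  LadderFreeBound : ℕ → Set
  LadderFreeBound j = ∀ U {L} → Unique L → AgreeOutside U L → ¬ Ladder L (2 + j) →
    length L ≤ 2 * suc (length U) ^ j

  ¬Ladder₂⇒length≤2 : LadderFreeBound 0
  ¬Ladder₂⇒length≤2 [] u agree _ = ≤-trans (AgreeOutside[]⇒length≤1 u agree) (n≤1+n 1)
  ¬Ladder₂⇒length≤2 (v ∷ U) {L} u agree ¬lad with all? (v ∈?_) L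
  ... | yes all∋v = ¬Ladder₂⇒length≤2 U u (AgreeOutside-all∋ agree all∋v) ¬lad
  ... | no ¬all∋v with find (¬All⇒Any¬ (v ∈?_) L ¬all∋v)
  ... | f₀ , f₀∈L , v∉f₀ = subst (_≤ 2) (length-containing+avoiding v L)
    (+-mono-≤ (¬Ladder₁⇒length≤1 (Unique.filter⁺ _ u) (¬lad ∘ rung f₀∈L v∉f₀))
              (pairwise-⊆⇒length≤1 (Unique.filter⁺ _ u) (λ f∈ g∈ → unseparated⇒⊆ (separation f∈ g∈))))
    where
    -- a vertex x missed by g but not by f yields the ladder (x, g), (v, f)
    separation : ∀ {f g x} → f ∈ₗ avoiding v L → g ∈ₗ avoiding v L → x ∉ g → x ∈ f → ⊥
    separation f∈ g∈ x∉g x∈f =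
      let f∈L , v∉f = ∈-avoiding⁻ L f∈ in
      ¬lad (rung (proj₁ (∈-avoiding⁻ L g∈)) x∉g (rung (∈-filter⁺ (_ ∈?_) f∈L x∈f) v∉f []))

  LadderFreeBound-suc : ∀ {j} → LadderFreeBound j → LadderFreeBound (suc j)
  LadderFreeBound-suc {j} _ [] u agree _ =
    ≤-trans (AgreeOutside[]⇒length≤1 u agree) (≤-trans (m^n>0 1 (suc j)) (m≤n*m _ 2))
  LadderFreeBound-suc {j} bound (v ∷ U) {L} u agree ¬lad with all? (v ∈?_) L
  ... | yes all∋v = ≤-trans
    (LadderFreeBound-suc bound U u (AgreeOutside-all∋ agree all∋v) ¬lad)
    (*-monoʳ-≤ 2 (^-monoˡ-≤ (suc j) (n≤1+n _)))
  ... | no ¬all∋v with find (¬All⇒Any¬ (v ∈?_) L ¬all∋v)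
  ... | f₀ , f₀∈L , v∉f₀ = begin
    length L                                         ≡⟨ sym (length-containing+avoiding v L) ⟩
    length (containing v L) + length (avoiding v L)  ≤⟨ +-mono-≤ containing≤ avoiding≤ ⟩
    2 * suc (suc ∣U∣) ^ j + 2 * suc ∣U∣ ^ suc j     ≡⟨ sym (*-distribˡ-+ 2 (suc (suc ∣U∣) ^ j) _) ⟩
    2 * (suc (suc ∣U∣) ^ j + suc ∣U∣ ^ suc j)
      ≤⟨ *-monoʳ-≤ 2 ([1+m]^j+m^[1+j]≤[1+m]^[1+j] (suc ∣U∣) j) ⟩
    2 * suc (suc ∣U∣) ^ suc j                       ∎
    where
    open ≤-Reasoning
    ∣U∣ = length U
    containing≤ : length (containing v L) ≤ 2 * suc (suc ∣U∣) ^ j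
    containing≤ = bound (v ∷ U) (Unique.filter⁺ _ u) (AgreeOutside-⊆ (filter-⊆ _ _) agree)
      (¬lad ∘ rung f₀∈L v∉f₀)
    avoiding≤ : length (avoiding v L) ≤ 2 * suc ∣U∣ ^ suc j
    avoiding≤ = LadderFreeBound-suc bound U (Unique.filter⁺ _ u) (AgreeOutside-avoiding agree)
      (¬lad ∘ Ladder-mono (filter-⊆ _ _))

  ladderFreeBound : ∀ j → LadderFreeBound j
  ladderFreeBound zero    = ¬Ladder₂⇒length≤2
  ladderFreeBound (suc j) = LadderFreeBound-suc (ladderFreeBound j)

  -- SemiLadder L d is Rungs L (suc d).
  Rungs : List (Subset n) → ℕ → Set
  Rungs L k = Σ (Fin k → Fin n) λ w → Σ (Fin k → Subset n) λ f →
    ((i : Fin k) → f i ∈ₗ L) × ((i : Fin k) → w i ∉ f i) × ((i j : Fin k) → i <ᶠ j → w i ∈ f j)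

  Ladder⇒Rungs : ∀ {L k} → Ladder L k → Rungs L k
  Ladder⇒Rungs []                                  = (λ ()) , (λ ()) , (λ ()) , (λ ()) , λ ()
  Ladder⇒Rungs {L} (rung {w = w} {f} f∈L w∉f lad) with Ladder⇒Rungs lad
  ... | ws , fs , fs∈ , ws∉fs , ordered =
    w ∷ᵛ ws , f ∷ᵛ fs ,
    (λ { zero → f∈L ; (suc i) → proj₁ (∈-containing⁻ L (fs∈ i)) }) ,
    (λ { zero → w∉f ; (suc i) → ws∉fs i }) ,
    λ { zero    (suc j) _         → proj₂ (∈-containing⁻ L (fs∈ j))
      ; (suc i) (suc j) (s≤s i<j) → ordered i j i<j }

  Flat⇒¬Ladder : ∀ {E d} → Flat E d → ¬ Ladder E (2 + d)
  Flat⇒¬Ladder flat = flat ∘ Ladder⇒Rungs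

  degree≤ : ∀ {E d} → Unique E → Reduced E → Flat E (suc d) →
    ∀ v → length (containing v E) ≤ 2 * suc n ^ d
  degree≤ {E} {d} u reduced flat v with reduced v
  ... | f₀ , f₀∈E , v∉f₀ =
    subst (λ m → length (containing v E) ≤ 2 * suc m ^ d) (length-tabulate id)
    (ladderFreeBound d (allFin n) (Unique.filter⁺ _ u) (λ _ _ x∉U → contradiction (∈-allFin _) x∉U)
      (Flat⇒¬Ladder flat ∘ rung f₀∈E v∉f₀))

length-containing-∷ : ∀ {n} (v : Fin n) e E →
  length (containing v (e ∷ E)) ≡ length (containing v (e ∷ [])) + length (containing v E)
length-containing-∷ v e E with v ∈? e
... | yes _ = refl
... | no  _ = refl

length-containing-suc-singleton : ∀ {n} {s} (e : Subset n) v →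
  length (containing (suc v) ((s ∷ e) ∷ [])) ≡ length (containing v (e ∷ []))
length-containing-suc-singleton e v with v ∈? e
... | yes _ = refl
... | no  _ = refl

∑-length-containing-singleton : ∀ {n} (e : Subset n) →
  ∑[ v < n ] length (containing v (e ∷ [])) ≡ ∣ e ∣
∑-length-containing-singleton []            = refl
∑-length-containing-singleton (inside  ∷ e) =
  cong suc
    (trans (sum-cong-≗ (length-containing-suc-singleton e)) (∑-length-containing-singleton e))
∑-length-containing-singleton (outside ∷ e) =
  trans (sum-cong-≗ (length-containing-suc-singleton e)) (∑-length-containing-singleton e)

∑-length-containing : ∀ {n} (E : List (Subset n)) → ∑[ v < n ] length (containing v E) ≡ size E
∑-length-containing {n} []      = sum-replicate-zero n
∑-length-containing {n} (e ∷ E) = begin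
  ∑[ v < n ] length (containing v (e ∷ E))
    ≡⟨ sum-cong-≗ (λ v → length-containing-∷ v e E) ⟩
  ∑[ v < n ] (length (containing v (e ∷ [])) + length (containing v E))
    ≡⟨ ∑-distrib-+ (λ v → length (containing v (e ∷ []))) (λ v → length (containing v E)) ⟩
  ∑[ v < n ] length (containing v (e ∷ [])) + ∑[ v < n ] length (containing v E)
    ≡⟨ cong₂ _+_ (∑-length-containing-singleton e) (∑-length-containing E) ⟩
  ∣ e ∣ + size E ∎
  where open ≡-Reasoning

∑-≤-* : ∀ {n} (f : Fin n → ℕ) {b} → (∀ i → f i ≤ b) → ∑[ i < n ] f i ≤ n * b
∑-≤-* {zero}  f f≤b = z≤n
∑-≤-* {suc n} f f≤b = +-mono-≤ (f≤b zero) (∑-≤-* (f ∘ suc) (f≤b ∘ suc))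

^-distribʳ-* : ∀ m n d → (m * n) ^ d ≡ m ^ d * n ^ d
^-distribʳ-* m n zero    = refl
^-distribʳ-* m n (suc d) =
  trans (cong (m * n *_) (^-distribʳ-* m n d)) ([m*n]*[o*p]≡[m*o]*[n*p] m n (m ^ d) (n ^ d))

n*[2*[1+n]^d]≤2^[1+d]*n^[1+d] : ∀ n d → n * (2 * suc n ^ d) ≤ 2 ^ suc d * n ^ suc d
n*[2*[1+n]^d]≤2^[1+d]*n^[1+d] zero      d = z≤n
n*[2*[1+n]^d]≤2^[1+d]*n^[1+d] n@(suc _) d = begin
  n * (2 * suc n ^ d)        ≤⟨ *-monoʳ-≤ n (*-monoʳ-≤ 2 (^-monoˡ-≤ d 1+n≤2*n)) ⟩
  n * (2 * (2 * n) ^ d)      ≡⟨ cong (λ x → n * (2 * x)) (^-distribʳ-* 2 n d) ⟩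
  n * (2 * (2 ^ d * n ^ d))  ≡⟨ regroup n (2 ^ d) (n ^ d) ⟩
  2 ^ suc d * n ^ suc d      ∎
  where
  open ≤-Reasoning
  1+n≤2*n : suc n ≤ 2 * n
  1+n≤2*n = +-mono-≤ (s≤s z≤n) (m≤n*m n 1)
  regroup : ∀ a b c → a * (2 * (b * c)) ≡ 2 * b * (a * c)
  regroup = solve-∀

theorem2 : (d : ℕ) → 1 ≤ d →
    ∃ λ (C : ℕ) → (n : ℕ) (E : List (Subset n)) →
      Unique E → Reduced E → Flat E d → size E ≤ C * n ^ d
theorem2 (suc d) _ = 2 ^ suc d , λ n E u reduced flat → begin
  size E                                  ≡⟨ sym (∑-length-containing E) ⟩
  ∑[ v < n ] length (containing v E)      ≤⟨ ∑-≤-* _ (degree≤ u reduced flat) ⟩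
  n * (2 * suc n ^ d)                     ≤⟨ n*[2*[1+n]^d]≤2^[1+d]*n^[1+d] n d ⟩
  2 ^ suc d * n ^ suc d                   ∎
  where open ≤-Reasoning
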